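{- The relation $\equiv$ on $\mathcal{C}$ defined by $X\equiv Y$ iff $\vdash\lfloor X\leftrightarrow Y\rfloor$ is an equivalence relation, and if $X\equiv Y$ and $U\equiv V$ then $(X\to U)\equiv(Y\to V)$ and $[X]U\equiv[Y]V$.
   Context: $\mathcal{C}$: smallest set containing $\bot$ and a set $\mathcal{P}$ of atoms, closed under $X\to Y$ and $[X]Y$; $\neg X:=X\to\bot$, $X\vee Y:=\neg X\to Y$, $X\wedge Y:=\neg(\neg X\vee\neg Y)$, $\top:=\neg\bot$, $X\leftrightarrow Y:=(X\to Y)\wedge(Y\to X)$. Bayesian propositions $\lfloor X_1|\cdots|X_n\rfloor$ ($n\ge1$); $\Gamma,\Delta$ finite possibly empty sequences. Proof system: axioms $\lfloor A\rfloor$ for instances over $\mathcal{C}$ of a standard Hilbert system for classical propositional logic; $\lfloor[X](Y\to Z)\to([X]Y\to[X]Z)\rfloor$; $\lfloor[X]Y\to(X\to Y)\rfloor$; $\lfloor[X]\neg Y\leftrightarrow\neg[X]Y\rfloor$. Rules: from $\lfloor\Gamma|X\rfloor$, $\lfloor\Delta|X\to Y\rfloor$ infer $\lfloor\Gamma|\Delta|Y\rfloor$; permutation of components; from $\lfloor\Gamma|X|X\rfloor$ infer $\lfloor\Gamma|X\rfloor$; from $\lfloor\Gamma\rfloor$ infer $\lfloor\Gamma|X\rfloor$; from $\lfloor\Gamma|X\to Y\rfloor$ infer $\lfloor\Gamma|\neg X|[X]Y\rfloor$; from $\lfloor\Gamma|Y\leftrightarrow\neg X\rfloor$, $\lfloor\Gamma|[X]Z\leftrightarrow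 Z\rfloor$ infer $\lfloor\Gamma|[Y]Z\leftrightarrow Z\rfloor$. $\vdash$ means derivable. -}

module Defs where

open import Data.List using (List; []; _∷_; [_]; _++_)
open import Data.List.Relation.Binary.Permutation.Propositional using (_↭_)
open import Data.Product using (_×_)

data Fm (P : Set) : Set where
  ⊥'   : Fm P
  atom : P → Fm P
  _⇒_  : Fm P → Fm P → Fm P
  ⟦_⟧_ : Fm P → Fm P → Fm P

infixr 5 _⇒_
infixr 6 ⟦_⟧_

module _ {P : Set} where
  ¬' : Fm P → Fm P
  ¬' X = X ⇒ ⊥'

  _∨'_ : Fm P → Fm P → Fm P
  X ∨' Y = ¬' X ⇒ Y

  _∧'_ : Fm P → Fm P → Fm P
  X ∧' Y = ¬' (¬' X ∨' ¬' Y)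

  ⊤' : Fm P
  ⊤' = ¬' ⊥'

  _⇔'_ : Fm P → Fm P → Fm P
  X ⇔' Y = (X ⇒ Y) ∧' (Y ⇒ X)

  -- A standard Hilbert system for classical propositional logic (Łukasiewicz axioms
  -- over → and ⊥, with ¬ X := X → ⊥); its axiom instances over 𝒞.
  data ClassicalAxiom : Fm P → Set where
    ax-K : ∀ X Y → ClassicalAxiom (X ⇒ (Y ⇒ X))
    ax-S : ∀ X Y Z → ClassicalAxiom ((X ⇒ (Y ⇒ Z)) ⇒ ((X ⇒ Y) ⇒ (X ⇒ Z)))
    ax-C : ∀ X Y → ClassicalAxiom ((¬' X ⇒ ¬' Y) ⇒ (Y ⇒ X))

  -- Bayesian propositions ⌊X₁|⋯|Xₙ⌋ are represented by their list of components;
  -- derivability ⊢ is defined inductively by the axioms and rules.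
  data ⊢_ : List (Fm P) → Set where
    ax-cl   : ∀ {A} → ClassicalAxiom A → ⊢ [ A ]
    ax-dist : ∀ X Y Z → ⊢ [ (⟦ X ⟧ (Y ⇒ Z)) ⇒ ((⟦ X ⟧ Y) ⇒ (⟦ X ⟧ Z)) ]
    ax-T    : ∀ X Y → ⊢ [ (⟦ X ⟧ Y) ⇒ (X ⇒ Y) ]
    ax-neg  : ∀ X Y → ⊢ [ (⟦ X ⟧ (¬' Y)) ⇔' (¬' (⟦ X ⟧ Y)) ]
    r-mp    : ∀ Γ Δ X Y → ⊢ (Γ ++ [ X ]) → ⊢ (Δ ++ [ X ⇒ Y ]) → ⊢ (Γ ++ Δ ++ [ Y ])
    r-perm  : ∀ {Γ Γ'} → Γ ↭ Γ' → ⊢ Γ → ⊢ Γ'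
    r-contr : ∀ Γ X → ⊢ (Γ ++ X ∷ X ∷ []) → ⊢ (Γ ++ [ X ])
    r-weak  : ∀ Γ X → ⊢ Γ → ⊢ (Γ ++ [ X ])
    r-nec   : ∀ Γ X Y → ⊢ (Γ ++ [ X ⇒ Y ]) → ⊢ (Γ ++ ¬' X ∷ [ ⟦ X ⟧ Y ])
    r-sub   : ∀ Γ X Y Z → ⊢ (Γ ++ [ Y ⇔' ¬' X ]) → ⊢ (Γ ++ [ (⟦ X ⟧ Z) ⇔' Z ])
            → ⊢ (Γ ++ [ (⟦ Y ⟧ Z) ⇔' Z ])

  _≋_ : Fm P → Fm P → Set
  X ≋ Y = ⊢ [ X ⇔' Y ]

module Submission where

-- Reflexivity, symmetry, transitivity and congruence for
-- _⇒_ are pure classical propositional logic, obtained via a deduction theorem for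
-- derivations from hypotheses built on top of the Hilbert axioms.  The substance
-- is congruence for boxes, [X]U ≋ [Y]V, which splits into monotonicity in the body
-- (U ⇒ V gives [X]U ⇒ [X]V) and invariance in the index (X ⇔ Y gives
-- [X]U ⇒ [Y]U).  Both use a case analysis on the index X inside two-component
-- propositions ⌊c ∣ A⌋: necessitation produces ⌊¬X ∣ [X]…⌋ (the branch where X
-- holds, with ¬X as the alternative), while in any branch ⌊c ∣ ¬X⌋ the substitution
-- rule shows [X]Z ⇔ Z, so boxes indexed by a false formula are transparent.  If a
-- goal G holds in both branches, contraction of ⌊G ∣ G⌋ yields ⌊G⌋.  Index
-- invariance additionally uses that the formulas Z with ⌊c ∣ [X]Z ⇔ Z⌋ do not
-- change when X is replaced by an equivalent formula (two uses of the substitution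
-- rule, through ¬X).

open import Defs
open import Data.Product using (_×_; _,_)
open import Relation.Binary.Structures using (IsEquivalence)
open import Data.List using (List; []; _∷_; [_])
open import Data.List.Membership.Propositional using (_∈_)
open import Data.List.Relation.Unary.Any using (here; there)
open import Data.List.Relation.Binary.Permutation.Propositional using (prep; swap; trans; refl)
open import Relation.Binary.PropositionalEquality using () renaming (refl to ≡-refl)

module Lemmas {P : Set} where
  F : Set
  F = Fm P

  ⌊_⌋ : F → Set
  ⌊ A ⌋ = ⊢ [ A ]

  mp₁ : ∀ {A B} → ⌊ A ⌋ → ⌊ A ⇒ B ⌋ → ⌊ B ⌋
  mp₁ {A} {B} a f = r-mp [] [] A B a f

  ⇒-refl : ∀ {A} → ⌊ A ⇒ A ⌋
  ⇒-refl {A} = mp₁ (ax-cl (ax-K A A)) (mp₁ (ax-cl (ax-K A (A ⇒ A))) (ax-cl (ax-S A (A ⇒ A) A)))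

  data Der (H : List F) : F → Set where
    thm : ∀ {A} → ⌊ A ⌋ → Der H A
    hyp : ∀ {A} → A ∈ H → Der H A
    mp  : ∀ {A B} → Der H (A ⇒ B) → Der H A → Der H B

  deduction : ∀ {H A B} → Der (A ∷ H) B → Der H (A ⇒ B)
  deduction {A = A} (thm t)          = thm (mp₁ t (ax-cl (ax-K _ A)))
  deduction (hyp (here ≡-refl))      = thm ⇒-refl
  deduction {A = A} (hyp (there a∈)) = mp (thm (ax-cl (ax-K _ A))) (hyp a∈)
  deduction (mp f x)                 = mp (mp (thm (ax-cl (ax-S _ _ _))) (deduction f)) (deduction x)

  closed : ∀ {A} → Der [] A → ⌊ A ⌋
  closed (thm t)  = t
  closed (hyp ())
  closed (mp f x) = mp₁ (closed x) (closed f)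

  weaken : ∀ {H A B} → Der H A → Der (B ∷ H) A
  weaken (thm t)  = thm t
  weaken (hyp a∈) = hyp (there a∈)
  weaken (mp f x) = mp (weaken f) (weaken x)

  h₀ : ∀ {H A} → Der (A ∷ H) A
  h₀ = hyp (here ≡-refl)
  h₁ : ∀ {H A B} → Der (B ∷ A ∷ H) A
  h₁ = hyp (there (here ≡-refl))
  h₂ : ∀ {H A B C} → Der (C ∷ B ∷ A ∷ H) A
  h₂ = hyp (there (there (here ≡-refl)))
  h₃ : ∀ {H A B C D} → Der (D ∷ C ∷ B ∷ A ∷ H) A
  h₃ = hyp (there (there (there (here ≡-refl))))

  ⊤-intro : ⌊ ⊤' ⌋
  ⊤-intro = ⇒-refl

  ⊥-elim : ∀ {A} → ⌊ ⊥' ⇒ A ⌋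
  ⊥-elim {A} = closed (deduction (mp (mp (thm (ax-cl (ax-C A ⊤'))) (deduction (deduction h₂))) (thm ⊤-intro)))

  ex-falso : ∀ {H A} → Der H ⊥' → Der H A
  ex-falso d = mp (thm ⊥-elim) d

  ¬¬-elim : ∀ {A} → ⌊ ¬' (¬' A) ⇒ A ⌋
  ¬¬-elim {A} =
    closed (deduction (mp (mp (thm (ax-cl (ax-C A ⊤'))) (deduction (ex-falso (mp h₁ h₀)))) (thm ⊤-intro)))

  by-contradiction : ∀ {H A} → Der (¬' A ∷ H) ⊥' → Der H A
  by-contradiction d = mp (thm ¬¬-elim) (deduction d)

  ∧-intro : ∀ {H X Y} → Der H X → Der H Y → Der H (X ∧' Y)
  ∧-intro x y = deduction (mp (mp h₀ (deduction (mp h₀ (weaken (weaken x))))) (weaken y))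

  ∧-elimˡ : ∀ {H X Y} → Der H (X ∧' Y) → Der H X
  ∧-elimˡ c = by-contradiction (mp (weaken c) (deduction (ex-falso (mp h₀ h₁))))

  ∧-elimʳ : ∀ {H X Y} → Der H (X ∧' Y) → Der H Y
  ∧-elimʳ c = by-contradiction (mp (weaken c) (deduction h₁))

  ⇔-intro : ∀ {H X Y} → Der H (X ⇒ Y) → Der H (Y ⇒ X) → Der H (X ⇔' Y)
  ⇔-intro = ∧-intro

  ⇔-to : ∀ {H X Y} → Der H (X ⇔' Y) → Der H (X ⇒ Y)
  ⇔-to = ∧-elimˡ

  ⇔-from : ∀ {H X Y} → Der H (X ⇔' Y) → Der H (Y ⇒ X)
  ⇔-from = ∧-elimʳ

  ⇔-refl : ∀ {X} → ⌊ X ⇔' X ⌋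
  ⇔-refl = closed (⇔-intro (thm ⇒-refl) (thm ⇒-refl))

  ⇔-sym : ∀ {X Y} → ⌊ X ⇔' Y ⌋ → ⌊ Y ⇔' X ⌋
  ⇔-sym e = closed (⇔-intro (⇔-from (thm e)) (⇔-to (thm e)))

  ⇒-trans : ∀ {X Y Z} → ⌊ X ⇒ Y ⌋ → ⌊ Y ⇒ Z ⌋ → ⌊ X ⇒ Z ⌋
  ⇒-trans f g = closed (deduction (mp (thm g) (mp (thm f) h₀)))

  ⇔-trans : ∀ {X Y Z} → ⌊ X ⇔' Y ⌋ → ⌊ Y ⇔' Z ⌋ → ⌊ X ⇔' Z ⌋
  ⇔-trans e₁ e₂ = closed (⇔-intro
    (thm (⇒-trans (closed (⇔-to (thm e₁))) (closed (⇔-to (thm e₂)))))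
    (thm (⇒-trans (closed (⇔-from (thm e₂))) (closed (⇔-from (thm e₁))))))

  contrapose : ∀ {X Y} → ⌊ X ⇒ Y ⌋ → ⌊ ¬' Y ⇒ ¬' X ⌋
  contrapose f = closed (deduction (deduction (mp h₁ (mp (thm f) h₀))))

  constant : ∀ {X A} → ⌊ A ⌋ → ⌊ X ⇒ A ⌋
  constant {X} {A} a = mp₁ a (ax-cl (ax-K A X))

  ⇒-cong : ∀ {X Y U V} → ⌊ X ⇔' Y ⌋ → ⌊ U ⇔' V ⌋ → ⌊ (X ⇒ U) ⇔' (Y ⇒ V) ⌋
  ⇒-cong e₁ e₂ = closed (⇔-intro
    (deduction (deduction (mp (⇔-to (thm e₂)) (mp h₁ (mp (⇔-from (thm e₁)) h₀)))))
    (deduction (deduction (mp (⇔-from (thm e₂)) (mp h₁ (mp (⇔-to (thm e₁)) h₀))))))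

  ⇒-along-⇔ : ∀ {A B U V} → ⌊ U ⇒ V ⌋ → ⌊ (A ⇔' U) ⇒ ((B ⇔' V) ⇒ (A ⇒ B)) ⌋
  ⇒-along-⇔ f = closed (deduction (deduction (deduction
    (mp (⇔-from h₁) (mp (thm f) (mp (⇔-to h₂) h₀))))))

  ⇔-¬¬ : ∀ {X Y} → ⌊ (X ⇔' Y) ⇒ (Y ⇔' ¬' (¬' X)) ⌋
  ⇔-¬¬ = closed (deduction (⇔-intro
    (deduction (deduction (mp h₀ (mp (⇔-from h₂) h₁))))
    (deduction (by-contradiction (mp h₁ (deduction (mp h₁ (mp (⇔-to h₃) h₀))))))))

  -- Two-component propositions ⌊c ∣ A⌋, read "c or else A": the component c is
  -- carried along while theorems act on A.
  ⌊_∣_⌋ : F → F → Set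
  ⌊ c ∣ A ⌋ = ⊢ (c ∷ A ∷ [])

  swap-∣ : ∀ {a b} → ⌊ a ∣ b ⌋ → ⌊ b ∣ a ⌋
  swap-∣ {a} {b} = r-perm (swap a b refl)

  pad : ∀ {c A} → ⌊ A ⌋ → ⌊ c ∣ A ⌋
  pad {c} {A} t = swap-∣ (r-weak [ A ] c t)

  map-∣ : ∀ {c A B} → ⌊ c ∣ A ⌋ → ⌊ A ⇒ B ⌋ → ⌊ c ∣ B ⌋
  map-∣ {c} {A} {B} p f = r-mp [ c ] [] A B p f

  -- Binary version: the two copies of c produced by the rule of inference are
  -- merged by contraction.
  map₂-∣ : ∀ {c A B C} → ⌊ c ∣ A ⌋ → ⌊ c ∣ B ⌋ → ⌊ A ⇒ (B ⇒ C) ⌋ → ⌊ c ∣ C ⌋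
  map₂-∣ {c} {A} {B} {C} pa pb f =
    swap-∣ (r-contr [ C ] c (r-perm (trans (prep c (swap c C refl)) (swap c C refl))
      (r-mp [ c ] [ c ] B C pb (map-∣ pa f))))

  -- Case analysis on X: if G holds when X does (first premise, in the form produced
  -- by necessitation) and in every branch where ¬X holds, then G is a theorem.
  by-cases : ∀ {X G} → ⌊ ¬' X ∣ G ⌋ → (∀ {c} → ⌊ c ∣ ¬' X ⌋ → ⌊ c ∣ G ⌋) → ⌊ G ⌋
  by-cases {G = G} whenX whenNotX = r-contr [] G (whenNotX (swap-∣ whenX))

  necessitate : ∀ {X A B} → ⌊ X ⇒ (A ⇒ B) ⌋ → ⌊ ¬' X ∣ (⟦ X ⟧ A) ⇒ (⟦ X ⟧ B) ⌋
  necessitate {X} {A} {B} f = map-∣ (r-nec [] X (A ⇒ B) f) (ax-dist X A B)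

  true-index : ∀ {X U} → ⌊ X ⇒ ((⟦ X ⟧ U) ⇔' U) ⌋
  true-index {X} {U} = closed (deduction (⇔-intro
    (deduction (mp (mp (thm (ax-T X U)) h₀) h₁))
    (deduction (by-contradiction
      (mp (mp (mp (thm (ax-T X (¬' U))) (mp (⇔-from (thm (ax-neg X U))) h₀)) h₂) h₁)))))

  substitute : ∀ {c X Y Z} → ⌊ c ∣ Y ⇔' ¬' X ⌋ → ⌊ c ∣ (⟦ X ⟧ Z) ⇔' Z ⌋ → ⌊ c ∣ (⟦ Y ⟧ Z) ⇔' Z ⌋
  substitute {c} {X} {Y} {Z} = r-sub [ c ] X Y Z

  -- A false index makes a box transparent: from ¬X, X ⇔ ¬⊤, and [⊤]Z ⇔ Z holds.
  false-index : ∀ {c X Z} → ⌊ c ∣ ¬' X ⌋ → ⌊ c ∣ (⟦ X ⟧ Z) ⇔' Z ⌋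
  false-index p = substitute (map-∣ p ¬-to-⇔¬⊤) (pad (mp₁ ⊤-intro true-index))
    where
    ¬-to-⇔¬⊤ : ∀ {X} → ⌊ ¬' X ⇒ (X ⇔' ¬' ⊤') ⌋
    ¬-to-⇔¬⊤ = closed (deduction (⇔-intro
      (deduction (ex-falso (mp h₁ h₀))) (deduction (ex-falso (mp h₀ (thm ⊤-intro))))))

  -- Transparency ⌊c ∣ [X]Z ⇔ Z⌋ depends only on X up to equivalence: substitute ¬X
  -- for X, then any Y ⇔ ¬¬X for ¬X.
  transparent-resp-⇔ : ∀ {c X Y Z} → ⌊ c ∣ X ⇔' Y ⌋ → ⌊ c ∣ (⟦ X ⟧ Z) ⇔' Z ⌋ → ⌊ c ∣ (⟦ Y ⟧ Z) ⇔' Z ⌋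
  transparent-resp-⇔ e p = substitute (map-∣ e ⇔-¬¬) (substitute (pad ⇔-refl) p)

  box-mono : ∀ {X U V} → ⌊ U ⇒ V ⌋ → ⌊ (⟦ X ⟧ U) ⇒ (⟦ X ⟧ V) ⌋
  box-mono f = by-cases (necessitate (constant f))
    (λ ¬X → map₂-∣ (false-index ¬X) (false-index ¬X) (⇒-along-⇔ f))

  -- With Z = [X]U: when ¬X, both [X]U and [Y]U
  -- are transparent.  When X, necessitating X → (Z ⇔ U) makes Z transparent for
  -- index X, hence for Y; and necessitating Y → (Z ⇒ U) gives [Y]Z ⇒ [Y]U.
  box-index : ∀ {X Y U} → ⌊ X ⇔' Y ⌋ → ⌊ (⟦ X ⟧ U) ⇒ (⟦ Y ⟧ U) ⌋
  box-index {X} {Y} {U} e = by-cases whenX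
    (λ ¬X → map₂-∣ (false-index ¬X) (false-index (map-∣ ¬X ¬X⇒¬Y)) (⇒-along-⇔ ⇒-refl))
    where
    Z : F
    Z = ⟦ X ⟧ U
    ¬X⇒¬Y : ⌊ ¬' X ⇒ ¬' Y ⌋
    ¬X⇒¬Y = contrapose (closed (⇔-from (thm e)))
    X-transparent : ⌊ ¬' X ∣ (⟦ X ⟧ Z) ⇔' Z ⌋
    X-transparent = map₂-∣
      (necessitate (closed (deduction (⇔-to (mp (thm true-index) h₀)))))
      (necessitate (closed (deduction (⇔-from (mp (thm true-index) h₀)))))
      (closed (deduction (deduction (⇔-intro h₁ h₀))))
    Y-transparent : ⌊ ¬' X ∣ (⟦ Y ⟧ Z) ⇔' Z ⌋
    Y-transparent = transparent-resp-⇔ (pad e) X-transparent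
    Y-distributes : ⌊ ¬' X ∣ (⟦ Y ⟧ Z) ⇒ (⟦ Y ⟧ U) ⌋
    Y-distributes = swap-∣ (map-∣ (swap-∣ (necessitate Y⇒Z⇒U)) (contrapose (closed (⇔-to (thm e)))))
      where
      Y⇒Z⇒U : ⌊ Y ⇒ (Z ⇒ U) ⌋
      Y⇒Z⇒U = closed (deduction (⇔-to (mp (thm true-index) (mp (⇔-from (thm e)) h₀))))
    whenX : ⌊ ¬' X ∣ Z ⇒ (⟦ Y ⟧ U) ⌋
    whenX = map₂-∣ Y-transparent Y-distributes
      (closed (deduction (deduction (deduction (mp h₁ (mp (⇔-from h₂) h₀))))))

  ⟦⟧-cong : ∀ {X Y U V} → ⌊ X ⇔' Y ⌋ → ⌊ U ⇔' V ⌋ → ⌊ (⟦ X ⟧ U) ⇔' (⟦ Y ⟧ V) ⌋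
  ⟦⟧-cong e₁ e₂ = closed (⇔-intro
    (thm (⇒-trans (box-mono (closed (⇔-to (thm e₂)))) (box-index e₁)))
    (thm (⇒-trans (box-mono (closed (⇔-from (thm e₂)))) (box-index (⇔-sym e₁)))))

open Lemmas

mainTheorem10 : {P : Set} →
    IsEquivalence (_≋_ {P})
    × (∀ {X Y U V : Fm P} → X ≋ Y → U ≋ V → ((X ⇒ U) ≋ (Y ⇒ V)) × ((⟦ X ⟧ U) ≋ (⟦ Y ⟧ V)))
mainTheorem10 =
  record { refl = ⇔-refl ; sym = ⇔-sym ; trans = ⇔-trans } ,
  λ e₁ e₂ → ⇒-cong e₁ e₂ , ⟦⟧-cong e₁ e₂
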